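{- Let $R$ be an integral domain with unit, $p,q\in R$, $U=(U_n)$ with $U_0=0$, $U_1=1$, $U_n=pU_{n-1}-qU_{n-2}$, and $x_n=U_n/U_{n-1}$ for $n\ge2$. Let $F$ be the Fibonacci sequence ($F_0=0$, $F_1=1$, $F_n=F_{n-1}+F_{n-2}$). Then the sequence $y_n=x_{F_{n+2}+1}$, $n\ge0$, coincides with the sequence of approximations of the root of $t^2-pt+q$ produced by the secant method started from $y_0=x_2$ and $y_1=x_3$; that is, for all $n\ge2$ (whenever defined), $$x_{F_{n+2}+1}=\frac{x_{F_{n+1}+1}\,x_{F_{n}+1}-q}{x_{F_{n+1}+1}+x_{F_{n}+1}-p}.$$
   Context: The secant method for an equation $f(t)=0$ with initial approximations $y_0,y_1$ is $y_n=y_{n-1}-\dfrac{f(y_{n-1})(y_{n-1}-y_{n-2})}{f(y_{n-1})-f(y_{n-2})}$ for $n\ge2$; for $f(t)=t^2-pt+q$ this simplifies to $y_n=\dfrac{y_{n-1}y_{n-2}-q}{y_{n-1}+y_{n-2}-p}$. The paper regards these as approximations of the root of larger modulus of $t^2-pt+q$ (when it exists and is real). -}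

module Defs where

open import Level using (_⊔_)
open import Data.Nat using (ℕ; zero; suc; _∸_)
import Data.Nat as ℕ
open import Data.Sum using (_⊎_)
open import Relation.Nullary using (¬_)
open import Algebra.Bundles using (CommutativeRing)

record IsIntegralDomain {c ℓ} (R : CommutativeRing c ℓ) : Set (c ⊔ ℓ) where
  open CommutativeRing R
  field
    nontrivial     : ¬ (1# ≈ 0#)
    noZeroDivisors : ∀ x y → x * y ≈ 0# → x ≈ 0# ⊎ y ≈ 0#

fib : ℕ → ℕ
fib zero = 0
fib (suc zero) = 1
fib (suc (suc n)) = fib (suc n) ℕ.+ fib n

-- Formal fractions a/b over R (elements of the fraction field are those with b ≠ 0),
-- with the usual field operations written out on representatives.
module FractionField {c ℓ} (R : CommutativeRing c ℓ) where
  open CommutativeRing R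

  record Frac : Set c where
    constructor _//_
    field
      num : Carrier
      den : Carrier
  open Frac public

  Defined : Frac → Set ℓ
  Defined f = ¬ (den f ≈ 0#)

  NonZeroFrac : Frac → Set ℓ
  NonZeroFrac f = ¬ (num f ≈ 0#)

  _≃_ : Frac → Frac → Set ℓ
  f ≃ g = num f * den g ≈ num g * den f

  ι : Carrier → Frac
  ι r = r // 1#

  _+ᶠ_ : Frac → Frac → Frac
  f +ᶠ g = (num f * den g + num g * den f) // (den f * den g)

  _-ᶠ_ : Frac → Frac → Frac
  f -ᶠ g = (num f * den g - num g * den f) // (den f * den g)

  _*ᶠ_ : Frac → Frac → Frac
  f *ᶠ g = (num f * num g) // (den f * den g)

  _/ᶠ_ : Frac → Frac → Frac
  f /ᶠ g = (num f * den g) // (den f * num g)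

  infixl 7 _*ᶠ_ _/ᶠ_
  infixl 6 _+ᶠ_ _-ᶠ_
  infix 4 _≃_

  module Lucas (p q : Carrier) where
    U : ℕ → Carrier
    U zero = 0#
    U (suc zero) = 1#
    U (suc (suc n)) = p * U (suc n) - q * U n

    x : ℕ → Frac
    x n = U n // U (n ∸ 1)

module Submission where

-- Idea.  The theorem is an instance of a single identity valid for ALL
-- indices a, b of the Lucas sequence U in any commutative ring:
--
--   x_{a+b+1} = (x_{a+1} x_{b+1} - q) / (x_{a+1} + x_{b+1} - p),
--
-- read as cross-multiplication of formal fractions.  It follows from
-- the two addition formulas
--
--   U_{a+b+1} = U_{a+1} U_{b+1} - q U_a U_b,
--   U_{a+b}   = U_{a+1} U_b + U_a U_{b+1} - p U_a U_b,
--
-- which give numerator and denominator of x_{a+b+1}, and from the algebraic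
-- simplification of the secant step applied to two fractions.  Since
-- F_{n+2} = F_{n+1} + F_n, taking a = F_{n+1}, b = F_n gives the theorem.

open import Defs
open import Algebra.Bundles using (CommutativeRing; RawRing)
open import Data.Nat as ℕ using (ℕ; zero; suc)
import Data.Nat.Properties as ℕP
open import Data.Integer as ℤ using (ℤ; +_; -[1+_]; _⊖_; _◃_; sign; ∣_∣)
import Data.Integer.Properties as ℤP
open import Data.Sign as Sign using (Sign)
open import Data.Maybe using (Maybe; map)
open import Relation.Binary.Consequences using (dec⇒weaklyDec)
open import Relation.Binary.PropositionalEquality as ≡ using (_≡_)

-- The canonical ring homomorphism ℤ → R, used to run the ring solver with
-- integer coefficients in an arbitrary commutative ring R.
module IntegerCoefficients {c ℓ} (R : CommutativeRing c ℓ) where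
  open CommutativeRing R
  open import Algebra.Properties.Ring ring using (-0#≈0#; -‿involutive; -‿distribˡ-*; -‿distribʳ-*; -‿+-comm)
  open import Algebra.Properties.CommutativeSemigroup +-commutativeSemigroup using (interchange)
  open import Algebra.Properties.Semiring.Mult.TCOptimised semiring using (_×_; ×-homo-+; ×1-homo-*; 1+×)
  open import Relation.Binary.Reasoning.Setoid setoid
  open import Algebra.Solver.Ring.AlmostCommutativeRing
    using (AlmostCommutativeRing; fromCommutativeRing; _-Raw-AlmostCommutative⟶_)

  embed : ℤ → Carrier
  embed (+ n)      = n × 1#
  embed -[1+ n ] = - (suc n × 1#)

  +-cancel-‿ : ∀ u a b → (u + a) - (u + b) ≈ a - b
  +-cancel-‿ u a b = begin
    (u + a) + - (u + b)    ≈⟨ +-congˡ (sym (-‿+-comm u b)) ⟩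
    (u + a) + (- u + - b)  ≈⟨ interchange u a (- u) (- b) ⟩
    (u + - u) + (a - b)    ≈⟨ +-congʳ (-‿inverseʳ u) ⟩
    0# + (a - b)           ≈⟨ +-identityˡ (a - b) ⟩
    a - b                  ∎

  ⊖-homo : ∀ m n → embed (m ⊖ n) ≈ m × 1# - n × 1#
  ⊖-homo zero    zero    = sym (trans (+-congˡ -0#≈0#) (+-identityʳ 0#))
  ⊖-homo zero    (suc n) = sym (+-identityˡ _)
  ⊖-homo (suc m) zero    = sym (trans (+-congˡ -0#≈0#) (+-identityʳ _))
  ⊖-homo (suc m) (suc n) = begin
    embed (suc m ⊖ suc n)              ≡⟨ ≡.cong embed (ℤP.[1+m]⊖[1+n]≡m⊖n m n) ⟩
    embed (m ⊖ n)                      ≈⟨ ⊖-homo m n ⟩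
    m × 1# - n × 1#                ≈⟨ +-cancel-‿ 1# _ _ ⟨
    (1# + m × 1#) - (1# + n × 1#)  ≈⟨ +-cong (1+× m 1#) (-‿cong (1+× n 1#)) ⟨
    suc m × 1# - suc n × 1#        ∎

  +-homo : ∀ i j → embed (i ℤ.+ j) ≈ embed (i) + embed (j)
  +-homo (+ m)    (+ n)    = ×-homo-+ 1# m n
  +-homo (+ m)    -[1+ n ] = ⊖-homo m (suc n)
  +-homo -[1+ m ] (+ n)    = trans (⊖-homo n (suc m)) (+-comm _ _)
  +-homo -[1+ m ] -[1+ n ] = begin
    - (suc (suc (m ℕ.+ n)) × 1#)     ≡⟨ ≡.cong (λ k → - (suc k × 1#)) (ℕP.+-suc m n) ⟨
    - ((suc m ℕ.+ suc n) × 1#)       ≈⟨ -‿cong (×-homo-+ 1# (suc m) (suc n)) ⟩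
    - (suc m × 1# + suc n × 1#)      ≈⟨ -‿+-comm _ _ ⟨
    - (suc m × 1#) + - (suc n × 1#)  ∎

  -‿homo : ∀ i → embed (ℤ.- i) ≈ - embed (i)
  -‿homo (+ zero)  = sym -0#≈0#
  -‿homo (+ suc n) = refl
  -‿homo -[1+ n ]  = sym (-‿involutive _)

  signed : Sign → Carrier → Carrier
  signed Sign.+ r = r
  signed Sign.- r = - r

  signed-cong : ∀ s {r t} → r ≈ t → signed s r ≈ signed s t
  signed-cong Sign.+ e = e
  signed-cong Sign.- e = -‿cong e

  signed-* : ∀ s t r u → signed (s Sign.* t) (r * u) ≈ signed s r * signed t u
  signed-* Sign.+ Sign.+ r u = refl
  signed-* Sign.+ Sign.- r u = -‿distribʳ-* r u
  signed-* Sign.- Sign.+ r u = -‿distribˡ-* r u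
  signed-* Sign.- Sign.- r u = begin
    r * u          ≈⟨ -‿involutive _ ⟨
    - - (r * u)    ≈⟨ -‿cong (-‿distribˡ-* r u) ⟩
    - (- r * u)    ≈⟨ -‿distribʳ-* _ u ⟩
    - r * - u      ∎

  ◃-homo : ∀ s n → embed (s ◃ n) ≈ signed s (n × 1#)
  ◃-homo Sign.+ zero    = refl
  ◃-homo Sign.- zero    = sym -0#≈0#
  ◃-homo Sign.+ (suc n) = refl
  ◃-homo Sign.- (suc n) = refl

  sign-abs : ∀ i → embed (i) ≈ signed (sign i) (∣ i ∣ × 1#)
  sign-abs (+ zero)  = refl
  sign-abs (+ suc n) = refl
  sign-abs -[1+ n ]  = refl

  *-homo : ∀ i j → embed (i ℤ.* j) ≈ embed (i) * embed (j)
  *-homo i j = begin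
    embed (i ℤ.* j)
      ≈⟨ ◃-homo (sign i Sign.* sign j) (∣ i ∣ ℕ.* ∣ j ∣) ⟩
    signed (sign i Sign.* sign j) ((∣ i ∣ ℕ.* ∣ j ∣) × 1#)
      ≈⟨ signed-cong (sign i Sign.* sign j) (×1-homo-* ∣ i ∣ ∣ j ∣) ⟩
    signed (sign i Sign.* sign j) ((∣ i ∣ × 1#) * (∣ j ∣ × 1#))
      ≈⟨ signed-* (sign i) (sign j) _ _ ⟩
    signed (sign i) (∣ i ∣ × 1#) * signed (sign j) (∣ j ∣ × 1#)
      ≈⟨ *-cong (sign-abs i) (sign-abs j) ⟨
    embed (i) * embed (j)
      ∎

  ℤ-rawRing : RawRing _ _
  ℤ-rawRing = record
    { Carrier = ℤ ; _≈_ = _≡_ ; _+_ = ℤ._+_ ; _*_ = ℤ._*_ ; -_ = ℤ.-_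
    ; 0# = + 0 ; 1# = + 1 }

  ACR : AlmostCommutativeRing c ℓ
  ACR = fromCommutativeRing R

  homomorphism : ℤ-rawRing -Raw-AlmostCommutative⟶ ACR
  homomorphism = record
    { ⟦_⟧ = embed ; +-homo = +-homo ; *-homo = *-homo ; -‿homo = -‿homo
    ; 0-homo = refl ; 1-homo = refl }

  coefficient-equality : ∀ i j → Maybe (embed (i) ≈ embed (j))
  coefficient-equality i j = map (λ { ≡.refl → refl }) (dec⇒weaklyDec ℤP._≟_ i j)

  open import Algebra.Solver.Ring ℤ-rawRing ACR homomorphism coefficient-equality public

module LucasIdentities {c ℓ} (R : CommutativeRing c ℓ) (p q : CommutativeRing.Carrier R) where
  open CommutativeRing R
  open IntegerCoefficients R using (solve; _:=_; _:+_; _:*_; _:-_; con)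
  open import Relation.Binary.Reasoning.Setoid setoid
  open FractionField R
  open Lucas p q

  -- U_{a+b+1} = U_{a+1} U_{b+1} - q U_a U_b, by induction on a: both sides
  -- satisfy the Lucas recurrence in a.
  U-add-suc : ∀ a b → U (suc (a ℕ.+ b)) ≈ U (suc a) * U (suc b) - q * U a * U b
  U-add-suc zero b =
    solve 3 (λ q s t → s := con (+ 1) :* s :- q :* con (+ 0) :* t) refl q (U (suc b)) (U b)
  U-add-suc (suc zero) b =
    solve 4 (λ p q s t → p :* s :- q :* t
                       := (p :* con (+ 1) :- q :* con (+ 0)) :* s :- q :* con (+ 1) :* t)
      refl p q (U (suc b)) (U b)
  U-add-suc (suc (suc a)) b = begin
    p * U (suc (suc a ℕ.+ b)) - q * U (suc (a ℕ.+ b))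
      ≈⟨ +-cong (*-congˡ (U-add-suc (suc a) b)) (-‿cong (*-congˡ (U-add-suc a b))) ⟩
    p * (U (suc (suc a)) * U (suc b) - q * U (suc a) * U b)
      - q * (U (suc a) * U (suc b) - q * U a * U b)
      ≈⟨ step p q (U (suc a)) (U a) (U (suc b)) (U b) ⟩
    U (suc (suc (suc a))) * U (suc b) - q * U (suc (suc a)) * U b
      ∎
    where
    step : ∀ p q u v s t → p * ((p * u - q * v) * s - q * u * t) - q * (u * s - q * v * t)
         ≈ (p * (p * u - q * v) - q * u) * s - q * (p * u - q * v) * t
    step = solve 6 (λ p q u v s t →
        p :* ((p :* u :- q :* v) :* s :- q :* u :* t) :- q :* (u :* s :- q :* v :* t)
      := (p :* (p :* u :- q :* v) :- q :* u) :* s :- q :* (p :* u :- q :* v) :* t) refl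

  U-add : ∀ a b → U (a ℕ.+ b) ≈ U (suc a) * U b + U a * U (suc b) - p * U a * U b
  U-add zero b =
    solve 3 (λ p s t → t := con (+ 1) :* t :+ con (+ 0) :* s :- p :* con (+ 0) :* t)
      refl p (U (suc b)) (U b)
  U-add (suc zero) b =
    solve 4 (λ p q s t → s := (p :* con (+ 1) :- q :* con (+ 0)) :* t :+ con (+ 1) :* s :- p :* con (+ 1) :* t)
      refl p q (U (suc b)) (U b)
  U-add (suc (suc a)) b = begin
    p * U (suc a ℕ.+ b) - q * U (a ℕ.+ b)
      ≈⟨ +-cong (*-congˡ (U-add (suc a) b)) (-‿cong (*-congˡ (U-add a b))) ⟩
    p * (U (suc (suc a)) * U b + U (suc a) * U (suc b) - p * U (suc a) * U b)
      - q * (U (suc a) * U b + U a * U (suc b) - p * U a * U b)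
      ≈⟨ step p q (U (suc a)) (U a) (U (suc b)) (U b) ⟩
    U (suc (suc (suc a))) * U b + U (suc (suc a)) * U (suc b) - p * U (suc (suc a)) * U b
      ∎
    where
    step : ∀ p q u v s t → p * ((p * u - q * v) * t + u * s - p * u * t) - q * (u * t + v * s - p * v * t)
         ≈ (p * (p * u - q * v) - q * u) * t + (p * u - q * v) * s - p * (p * u - q * v) * t
    step = solve 6 (λ p q u v s t →
        p :* ((p :* u :- q :* v) :* t :+ u :* s :- p :* u :* t) :- q :* (u :* t :+ v :* s :- p :* v :* t)
      := (p :* (p :* u :- q :* v) :- q :* u) :* t :+ (p :* u :- q :* v) :* s :- p :* (p :* u :- q :* v) :* t) refl

  secant : Frac → Frac → Frac
  secant y z = (y *ᶠ z -ᶠ ι q) /ᶠ (y +ᶠ z -ᶠ ι p)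

  secant-fractions : ∀ s a t b →
    (s * t - q * a * b) // (s * b + a * t - p * a * b) ≃ secant (s // a) (t // b)
  secant-fractions s a t b = identity p q s a t b
    where
    identity : ∀ p q s a t b →
      (s * t - q * a * b) * ((a * b * 1#) * ((s * b + t * a) * 1# - p * (a * b)))
        ≈ ((s * t * 1# - q * (a * b)) * (a * b * 1#)) * (s * b + a * t - p * a * b)
    identity = solve 6 (λ p q s a t b →
        (s :* t :- q :* a :* b) :* ((a :* b :* con (+ 1)) :* ((s :* b :+ t :* a) :* con (+ 1) :- p :* (a :* b)))
      := ((s :* t :* con (+ 1) :- q :* (a :* b)) :* (a :* b :* con (+ 1))) :* (s :* b :+ a :* t :- p :* a :* b))
      refl

  ≃-respˡ : ∀ {n d n′ d′} g → n ≈ n′ → d ≈ d′ → n′ // d′ ≃ g → n // d ≃ g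
  ≃-respˡ g n≈n′ d≈d′ eq = trans (*-congʳ n≈n′) (trans eq (*-congˡ (sym d≈d′)))

  x-add : ∀ a b → x (suc (a ℕ.+ b)) ≃ secant (x (suc a)) (x (suc b))
  x-add a b = ≃-respˡ (secant (x (suc a)) (x (suc b)))
    (U-add-suc a b) (U-add a b) (secant-fractions (U (suc a)) (U a) (U (suc b)) (U b))

-- ℕ's _+_ is opened only from here on, since inside the ring modules it
-- would clash with the ring addition.
open import Data.Nat using (_≤_; _+_)

-- F_{n+2} = F_{n+1} + F_n, with the indices written as in the theorem.
fib-rec : ∀ n → fib (n + 2) ≡ fib (n + 1) + fib n
fib-rec n rewrite ℕP.+-comm n 2 | ℕP.+-comm n 1 = ≡.refl

theorem3p1 : ∀ {c ℓ} (R : CommutativeRing c ℓ) → IsIntegralDomain R →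
  let open CommutativeRing R using (Carrier) in
  let open FractionField R in
  (p q : Carrier) →
  let open Lucas p q in
  (n : ℕ) → 2 ≤ n →
  Defined (x (fib (n + 2) + 1)) →
  Defined (x (fib (n + 1) + 1)) →
  Defined (x (fib n + 1)) →
  NonZeroFrac (x (fib (n + 1) + 1) +ᶠ x (fib n + 1) -ᶠ ι p) →
  x (fib (n + 2) + 1)
    ≃ (x (fib (n + 1) + 1) *ᶠ x (fib n + 1) -ᶠ ι q)
      /ᶠ (x (fib (n + 1) + 1) +ᶠ x (fib n + 1) -ᶠ ι p)
-- After rewriting F_{n+2} + 1 as suc (F_{n+1} + F_n) and k + 1 as suc k,
-- the claim is x-add at a = F_{n+1}, b = F_n.
theorem3p1 R _ p q n _ _ _ _ _
  rewrite fib-rec n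
        | ℕP.+-comm (fib (n + 1) + fib n) 1
        | ℕP.+-comm (fib (n + 1)) 1
        | ℕP.+-comm (fib n) 1
  = LucasIdentities.x-add R p q (fib (n + 1)) (fib n)
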